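{- Let $0\le\gamma\le1$ and let $\tilde p_e=(1-\gamma)p_e$ for all $e\in E$; for $F\subseteq E$ let $\tilde f(F)=1-\prod_{e\in F}(1-\tilde p_e)$. If $f(F)$ is replaced by $\tilde f(F)$ in every constraint of $\mathrm{LP}_{QC}$, the optimal value of the resulting linear program is at least $(1-\gamma)$ times the optimal value of $\mathrm{LP}_{QC}$.
   Context: $G=(A,B,E)$ is a bipartite graph with nonnegative edge weights $w(e)$ and probabilities $p_e\in[0,1]$. For a vertex $u$, $\delta(u)$ is its set of incident edges; for $F\subseteq E$, $f(F)=1-\prod_{e\in F}(1-p_e)$. $\mathrm{LP}_{QC}$: maximize $\sum_{e\in E}x_e w(e)$ subject to $\sum_{e\in F}x_e\le f(F)$ for all $u\in A\cup B$ and all $F\subseteq\delta(u)$, and $x_e\ge0$ for all $e\in E$.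
   Formalization: The probabilities $p_e$, the edge weights $w(e)$, the parameter γ and the variables $x_e$ of both linear programs are rational. -}

module Defs where

open import Data.Nat using (ℕ; zero; suc)
open import Data.Fin using (Fin; zero; suc)
open import Data.Bool using (Bool; true; false; if_then_else_; T)
open import Data.Sum using (_⊎_; inj₁; inj₂)
open import Data.Product using (_×_; _,_)
open import Data.Rational using (ℚ; 0ℚ; 1ℚ; _+_; _*_; _-_; _≤_)
open import Relation.Binary.PropositionalEquality using (_≡_)
open import Function using (_∘_)

-- A finite bipartite graph G = (A, B, E) with A = Fin a, B = Fin b and
-- edge set E = Fin m; each edge e has endpoint  left e ∈ A  and  right e ∈ B.
record BipGraph : Set where
  field
    a b m : ℕ
    left  : Fin m → Fin a
    right : Fin m → Fin b

open BipGraph public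

Vertex : BipGraph → Set
Vertex G = Fin (a G) ⊎ Fin (b G)

Simple : BipGraph → Set
Simple G = ∀ e e′ → left G e ≡ left G e′ → right G e ≡ right G e′ → e ≡ e′

Incident : (G : BipGraph) → Vertex G → Fin (m G) → Set
Incident G (inj₁ u) e = left G e ≡ u
Incident G (inj₂ v) e = right G e ≡ v

EdgeSet : BipGraph → Set
EdgeSet G = Fin (m G) → Bool

_⊆δ_ : {G : BipGraph} → EdgeSet G → Vertex G → Set
_⊆δ_ {G} F u = ∀ e → T (F e) → Incident G u e

Σ[Fin] : ∀ {n} → (Fin n → ℚ) → ℚ
Σ[Fin] {zero}  g = 0ℚ
Σ[Fin] {suc n} g = g zero + Σ[Fin] (g ∘ suc)

Π[Fin] : ∀ {n} → (Fin n → ℚ) → ℚ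
Π[Fin] {zero}  g = 1ℚ
Π[Fin] {suc n} g = g zero * Π[Fin] (g ∘ suc)

sumOn : ∀ {n} → (Fin n → Bool) → (Fin n → ℚ) → ℚ
sumOn F x = Σ[Fin] (λ e → if F e then x e else 0ℚ)

fSet : ∀ {n} → (Fin n → ℚ) → (Fin n → Bool) → ℚ
fSet p F = 1ℚ - Π[Fin] (λ e → if F e then 1ℚ - p e else 1ℚ)

FeasibleQC : (G : BipGraph) → (Fin (m G) → ℚ) → (Fin (m G) → ℚ) → Set
FeasibleQC G p x =
  (∀ e → 0ℚ ≤ x e) ×
  (∀ (u : Vertex G) (F : EdgeSet G) → _⊆δ_ {G} F u → sumOn F x ≤ fSet p F)

objective : (G : BipGraph) → (Fin (m G) → ℚ) → (Fin (m G) → ℚ) → ℚ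
objective G w x = Σ[Fin] (λ e → x e * w e)

{-# OPTIONS --safe #-}
module Submission where

-- Take y = c x with c = 1 - γ; the objective scales by c and so does the
-- left side of every constraint. Writing P = Π_{e∈F} (1 - p_e) and
-- Q = Π_{e∈F} (1 - c p_e), the damped constraint then needs c (1 - P) ≤ 1 - Q,
-- i.e. Q lies below the chord (1 - c) + c P. This follows by induction over
-- the factors, since multiplying in one factor 1 - c q loses exactly c q (1 - c) (1 - P) ≥ 0.

open import Defs
open import Data.Nat using (ℕ; zero; suc)
open import Data.Fin using (Fin; zero; suc)
open import Data.Bool using (Bool; true; false; if_then_else_)
open import Data.Product using (Σ; _×_; _,_; proj₂)
open import Data.Rational using (ℚ; 0ℚ; 1ℚ; _+_; _*_; _-_; -_; _≤_; nonNegative)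
open import Data.Rational.Properties
open import Data.Rational.Solver using (module +-*-Solver)
open import Relation.Binary.PropositionalEquality
open import Function using (_∘_)

open +-*-Solver

private
  variable
    n : ℕ
    p q r : ℚ

p≤q⇒0≤q-p : p ≤ q → 0ℚ ≤ q - p
p≤q⇒0≤q-p {p} {q} p≤q = subst (_≤ q - p) (+-inverseʳ p) (+-monoˡ-≤ (- p) p≤q)

q-p≡r⇒0≤r⇒p≤q : q - p ≡ r → 0ℚ ≤ r → p ≤ q
q-p≡r⇒0≤r⇒p≤q {q} {p} q-p≡r 0≤r =
  subst₂ _≤_ (+-identityʳ p) p+[q-p]≡q (+-monoʳ-≤ p (subst (0ℚ ≤_) (sym q-p≡r) 0≤r))
  where
  p+[q-p]≡q : p + (q - p) ≡ q
  p+[q-p]≡q = solve 2 (λ p q → p :+ (q :- p) := q) refl p q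

0≤p⇒0≤q⇒0≤p*q : 0ℚ ≤ p → 0ℚ ≤ q → 0ℚ ≤ p * q
0≤p⇒0≤q⇒0≤p*q {p} {q} 0≤p 0≤q =
  nonNegative⁻¹ (p * q) {{nonNeg*nonNeg⇒nonNeg p {{nonNegative 0≤p}} q {{nonNegative 0≤q}}}}

*-monoˡ-≤-0≤ : 0ℚ ≤ r → p ≤ q → r * p ≤ r * q
*-monoˡ-≤-0≤ {r} 0≤r = *-monoˡ-≤-nonNeg r {{nonNegative 0≤r}}

p*q≤1 : 0ℚ ≤ p → p ≤ 1ℚ → q ≤ 1ℚ → p * q ≤ 1ℚ
p*q≤1 {p} 0≤p p≤1 q≤1 = ≤-trans (*-monoˡ-≤-0≤ 0≤p q≤1) (subst (_≤ 1ℚ) (sym (*-identityʳ p)) p≤1)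

1-p≤1 : 0ℚ ≤ p → 1ℚ - p ≤ 1ℚ
1-p≤1 {p} = q-p≡r⇒0≤r⇒p≤q (solve 1 (λ p → con 1ℚ :- (con 1ℚ :- p) := p) refl p)

Σ[Fin]-cong : {g h : Fin n → ℚ} → (∀ i → g i ≡ h i) → Σ[Fin] g ≡ Σ[Fin] h
Σ[Fin]-cong {zero}  g≗h = refl
Σ[Fin]-cong {suc n} g≗h = cong₂ _+_ (g≗h zero) (Σ[Fin]-cong (g≗h ∘ suc))

Π[Fin]-cong : {g h : Fin n → ℚ} → (∀ i → g i ≡ h i) → Π[Fin] g ≡ Π[Fin] h
Π[Fin]-cong {zero}  g≗h = refl
Π[Fin]-cong {suc n} g≗h = cong₂ _*_ (g≗h zero) (Π[Fin]-cong (g≗h ∘ suc))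

Σ[Fin]-*-distribˡ : ∀ c (g : Fin n → ℚ) → Σ[Fin] (λ i → c * g i) ≡ c * Σ[Fin] g
Σ[Fin]-*-distribˡ {zero}  c g = sym (*-zeroʳ c)
Σ[Fin]-*-distribˡ {suc n} c g = begin
  c * g zero + Σ[Fin] (λ i → c * g (suc i)) ≡⟨ cong (c * g zero +_) (Σ[Fin]-*-distribˡ c (g ∘ suc)) ⟩
  c * g zero + c * Σ[Fin] (g ∘ suc)         ≡⟨ *-distribˡ-+ c (g zero) (Σ[Fin] (g ∘ suc)) ⟨
  c * Σ[Fin] g                              ∎
  where open ≡-Reasoning

Π[Fin]-∈[0,1] : (g : Fin n → ℚ) → (∀ i → 0ℚ ≤ g i) → (∀ i → g i ≤ 1ℚ) →
  0ℚ ≤ Π[Fin] g × Π[Fin] g ≤ 1ℚ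
Π[Fin]-∈[0,1] {zero}  g 0≤g g≤1 = nonNegative⁻¹ 1ℚ , ≤-refl
Π[Fin]-∈[0,1] {suc n} g 0≤g g≤1 with Π[Fin]-∈[0,1] (g ∘ suc) (0≤g ∘ suc) (g≤1 ∘ suc)
... | 0≤Π , Π≤1 = 0≤p⇒0≤q⇒0≤p*q (0≤g zero) 0≤Π , p*q≤1 (0≤g zero) (g≤1 zero) Π≤1

[1-c*q]*[1-c+c*P]≤1-c+c*[[1-q]*P] : ∀ {c q P} → 0ℚ ≤ c → c ≤ 1ℚ → 0ℚ ≤ q → P ≤ 1ℚ →
  (1ℚ - c * q) * (1ℚ - c + c * P) ≤ 1ℚ - c + c * ((1ℚ - q) * P)
[1-c*q]*[1-c+c*P]≤1-c+c*[[1-q]*P] {c} {q} {P} 0≤c c≤1 0≤q P≤1 =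
  q-p≡r⇒0≤r⇒p≤q loss
    (0≤p⇒0≤q⇒0≤p*q (0≤p⇒0≤q⇒0≤p*q (0≤p⇒0≤q⇒0≤p*q 0≤c 0≤q) (p≤q⇒0≤q-p c≤1)) (p≤q⇒0≤q-p P≤1))
  where
  loss : (1ℚ - c + c * ((1ℚ - q) * P)) - (1ℚ - c * q) * (1ℚ - c + c * P)
       ≡ c * q * (1ℚ - c) * (1ℚ - P)
  loss = solve 3 (λ c q P →
      (con 1ℚ :- c :+ c :* ((con 1ℚ :- q) :* P)) :- (con 1ℚ :- c :* q) :* (con 1ℚ :- c :+ c :* P)
    := c :* q :* (con 1ℚ :- c) :* (con 1ℚ :- P)) refl c q P

Π[1-c*q]≤1-c+c*Π[1-q] : ∀ c (q : Fin n → ℚ) → 0ℚ ≤ c → c ≤ 1ℚ →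
  (∀ i → 0ℚ ≤ q i) → (∀ i → q i ≤ 1ℚ) →
  Π[Fin] (λ i → 1ℚ - c * q i) ≤ 1ℚ - c + c * Π[Fin] (λ i → 1ℚ - q i)
Π[1-c*q]≤1-c+c*Π[1-q] {zero} c q 0≤c c≤1 0≤q q≤1 =
  q-p≡r⇒0≤r⇒p≤q (solve 1 (λ c → con 1ℚ :- c :+ c :* con 1ℚ :- con 1ℚ := con 0ℚ) refl c) ≤-refl
Π[1-c*q]≤1-c+c*Π[1-q] {suc n} c q 0≤c c≤1 0≤q q≤1 = begin
  (1ℚ - c * q zero) * Π[Fin] (λ i → 1ℚ - c * q (suc i))
    ≤⟨ *-monoˡ-≤-0≤ 0≤1-c*q₀ (Π[1-c*q]≤1-c+c*Π[1-q] c (q ∘ suc) 0≤c c≤1 (0≤q ∘ suc) (q≤1 ∘ suc)) ⟩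
  (1ℚ - c * q zero) * (1ℚ - c + c * P)
    ≤⟨ [1-c*q]*[1-c+c*P]≤1-c+c*[[1-q]*P] 0≤c c≤1 (0≤q zero) P≤1 ⟩
  1ℚ - c + c * ((1ℚ - q zero) * P) ∎
  where
  open ≤-Reasoning
  P = Π[Fin] (λ i → 1ℚ - q (suc i))
  P≤1 : P ≤ 1ℚ
  P≤1 = Π[Fin]-∈[0,1] _ (p≤q⇒0≤q-p ∘ q≤1 ∘ suc) (1-p≤1 ∘ 0≤q ∘ suc) .proj₂
  0≤1-c*q₀ : 0ℚ ≤ 1ℚ - c * q zero
  0≤1-c*q₀ = p≤q⇒0≤q-p (p*q≤1 0≤c c≤1 (q≤1 zero))

restrict : (Fin n → Bool) → (Fin n → ℚ) → Fin n → ℚ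
restrict F x i = if F i then x i else 0ℚ

restrict-preserves : ∀ (F : Fin n → Bool) (P : ℚ → Set) {x} → P 0ℚ → (∀ i → P (x i)) →
  ∀ i → P (restrict F x i)
restrict-preserves F P P0 Px i with F i
... | true  = Px i
... | false = P0

restrict-*-distribˡ : ∀ (F : Fin n → Bool) c x i → restrict F (λ j → c * x j) i ≡ c * restrict F x i
restrict-*-distribˡ F c x i with F i
... | true  = refl
... | false = sym (*-zeroʳ c)

sumOn-*-distribˡ : ∀ (F : Fin n → Bool) c x → sumOn F (λ i → c * x i) ≡ c * sumOn F x
sumOn-*-distribˡ F c x = trans (Σ[Fin]-cong (restrict-*-distribˡ F c x)) (Σ[Fin]-*-distribˡ c (restrict F x))

fSet-restrict : ∀ (p : Fin n → ℚ) F → fSet p F ≡ 1ℚ - Π[Fin] (λ i → 1ℚ - restrict F p i)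
fSet-restrict p F = cong (_-_ 1ℚ) (Π[Fin]-cong if-complement)
  where
  if-complement : ∀ i → (if F i then 1ℚ - p i else 1ℚ) ≡ 1ℚ - restrict F p i
  if-complement i with F i
  ... | true  = refl
  ... | false = refl

c*fSet[p]≤fSet[c*p] : ∀ (p : Fin n → ℚ) F c → 0ℚ ≤ c → c ≤ 1ℚ →
  (∀ i → 0ℚ ≤ p i) → (∀ i → p i ≤ 1ℚ) →
  c * fSet p F ≤ fSet (λ i → c * p i) F
c*fSet[p]≤fSet[c*p] p F c 0≤c c≤1 0≤p p≤1 = begin
  c * fSet p F   ≡⟨ cong (c *_) (fSet-restrict p F) ⟩
  c * (1ℚ - P)   ≤⟨ q-p≡r⇒0≤r⇒p≤q chord-gap (p≤q⇒0≤q-p Q≤chord) ⟩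
  1ℚ - Q         ≡⟨ cong (_-_ 1ℚ) (Π[Fin]-cong (cong (_-_ 1ℚ) ∘ restrict-*-distribˡ F c p)) ⟨
  1ℚ - Π[Fin] (λ i → 1ℚ - restrict F (λ j → c * p j) i) ≡⟨ fSet-restrict (λ i → c * p i) F ⟨
  fSet (λ i → c * p i) F ∎
  where
  open ≤-Reasoning
  p↾F = restrict F p
  P = Π[Fin] (λ i → 1ℚ - p↾F i)
  Q = Π[Fin] (λ i → 1ℚ - c * p↾F i)
  Q≤chord : Q ≤ 1ℚ - c + c * P
  Q≤chord = Π[1-c*q]≤1-c+c*Π[1-q] c p↾F 0≤c c≤1
    (restrict-preserves F (0ℚ ≤_) ≤-refl 0≤p) (restrict-preserves F (_≤ 1ℚ) (nonNegative⁻¹ 1ℚ) p≤1)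
  chord-gap : (1ℚ - Q) - c * (1ℚ - P) ≡ (1ℚ - c + c * P) - Q
  chord-gap = solve 3 (λ c P Q → (con 1ℚ :- Q) :- c :* (con 1ℚ :- P) := (con 1ℚ :- c :+ c :* P) :- Q) refl c P Q

objective-*-distribˡ : ∀ G (w x : Fin (m G) → ℚ) c → objective G w (λ e → c * x e) ≡ c * objective G w x
objective-*-distribˡ G w x c =
  trans (Σ[Fin]-cong (λ e → *-assoc c (x e) (w e))) (Σ[Fin]-*-distribˡ c (λ e → x e * w e))

lemma3 : (G : BipGraph) → Simple G →
    (w p : Fin (m G) → ℚ) →
    (∀ e → 0ℚ ≤ w e) → (∀ e → 0ℚ ≤ p e) → (∀ e → p e ≤ 1ℚ) →
    (γ : ℚ) → 0ℚ ≤ γ → γ ≤ 1ℚ →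
    (x : Fin (m G) → ℚ) → FeasibleQC G p x →
    Σ (Fin (m G) → ℚ) (λ y →
      FeasibleQC G (λ e → (1ℚ - γ) * p e) y ×
      (1ℚ - γ) * objective G w x ≤ objective G w y)
lemma3 G _ w p _ 0≤p p≤1 γ 0≤γ γ≤1 x (0≤x , x-fits) =
  (λ e → c * x e) , (0≤y , y-fits) , ≤-reflexive (sym (objective-*-distribˡ G w x c))
  where
  c = 1ℚ - γ
  0≤c : 0ℚ ≤ c
  0≤c = p≤q⇒0≤q-p γ≤1
  0≤y : ∀ e → 0ℚ ≤ c * x e
  0≤y e = 0≤p⇒0≤q⇒0≤p*q 0≤c (0≤x e)
  y-fits : ∀ u F → _⊆δ_ {G} F u → sumOn F (λ e → c * x e) ≤ fSet (λ e → c * p e) F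
  y-fits u F F⊆δu = begin
    sumOn F (λ e → c * x e) ≡⟨ sumOn-*-distribˡ F c x ⟩
    c * sumOn F x           ≤⟨ *-monoˡ-≤-0≤ 0≤c (x-fits u F F⊆δu) ⟩
    c * fSet p F            ≤⟨ c*fSet[p]≤fSet[c*p] p F c 0≤c (1-p≤1 0≤γ) 0≤p p≤1 ⟩
    fSet (λ e → c * p e) F  ∎
    where open ≤-Reasoning
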